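{- For integers $0<k\le m\le n$, the number of free Dyck paths of length $2n$ with $m$ flaws and $k$ flaw blocks equals \[\frac{k}{2m-k}\binom{2m-k}{m}\cdot\frac{k+1}{2n-2m+k+1}\binom{2n-2m+k+1}{n-m}.\]
   Context: A free Dyck path of length $2n$ is a lattice path from $(0,0)$ to $(2n,0)$ with $n$ up steps $(1,1)$ and $n$ down steps $(1,-1)$. It has $m$ flaws if exactly $m$ of its up steps lie below the $x$-axis (go from height $-j$ to $-j+1$ with $j\ge 1$). A flaw block is a maximal segment of the path that starts and ends on the $x$-axis and is otherwise strictly below it; the number of flaw blocks equals the number of down steps from height $0$ to height $-1$. -}

module Defs where

open import Data.Bool using (Bool; true; false)
open import Data.Nat using (ℕ; zero; suc; _+_; _*_; _∸_; _/_; _≡ᵇ_)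
open import Data.Nat.Combinatorics using (_C_)
open import Data.Integer as ℤ using (ℤ; +_; -[1+_])
open import Data.List using (List; []; _∷_; length; map; _++_)
open import Data.Vec using (Vec; []; _∷_)

-- A step: true = up step (1,1), false = down step (1,-1).
-- A path of length L is a Vec Bool L, starting at height 0.

allPaths : (L : ℕ) → List (Vec Bool L)
allPaths zero = [] ∷ []
allPaths (suc L) = map (true ∷_) (allPaths L) ++ map (false ∷_) (allPaths L)

ups : ∀ {L} → Vec Bool L → ℕ
ups [] = 0
ups (true ∷ s) = suc (ups s)
ups (false ∷ s) = ups s

-- flaws of the path started at height h: up steps from height -j to -j+1, j ≥ 1
flawsFrom : ∀ {L} → ℤ → Vec Bool L → ℕ
flawsFrom h [] = 0
flawsFrom (+ n) (true ∷ s) = flawsFrom (+ suc n) s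
flawsFrom -[1+ j ] (true ∷ s) = suc (flawsFrom (-[1+ j ] ℤ.+ ℤ.1ℤ) s)
flawsFrom h (false ∷ s) = flawsFrom (h ℤ.- ℤ.1ℤ) s

-- flaw blocks of the path started at height h:
-- down steps from height 0 to height -1
blocksFrom : ∀ {L} → ℤ → Vec Bool L → ℕ
blocksFrom h [] = 0
blocksFrom h (true ∷ s) = blocksFrom (h ℤ.+ ℤ.1ℤ) s
blocksFrom (+ zero) (false ∷ s) = suc (blocksFrom -[1+ 0 ] s)
blocksFrom h (false ∷ s) = blocksFrom (h ℤ.- ℤ.1ℤ) s

flaws : ∀ {L} → Vec Bool L → ℕ
flaws = flawsFrom (+ 0)

flawBlocks : ∀ {L} → Vec Bool L → ℕ
flawBlocks = blocksFrom (+ 0)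

-- Boolean test: a free Dyck path of length 2n (n up steps, hence n down steps,
-- so it ends on the x-axis) with m flaws and k flaw blocks.
isCounted : (n m k : ℕ) → Vec Bool (2 * n) → Bool
isCounted n m k p = (ups p ≡ᵇ n) ∧ (flaws p ≡ᵇ m) ∧ (flawBlocks p ≡ᵇ k)
  where open import Data.Bool using (_∧_)

countPaths : (n m k : ℕ) → ℕ
countPaths n m k = length (Data.List.filterᵇ (isCounted n m k) (allPaths (2 * n)))
  where import Data.List

module Submission where

-- Following a path step by step gives a recursion for the number of paths with prescribed
-- numbers of up steps, flaws and flaw blocks. Its solution factorises: from height p ≥ 0, the
-- completions ending at height 0 with u up steps, f flaws and b ≥ 1 flaw blocks number
--   ballot (p + b) (u − f) · ballot (b − 1) (f − b),
-- where ballot q a counts the paths from height q to height 0 with a up steps that never go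
-- below 0, and (2a + q + 1) · ballot q a = (q + 1) · C(2a + q + 1, a) by the reflection
-- principle. The factorisation is checked against the recursion by induction on the length,
-- each step being a Pascal-type recurrence of ballot numbers; for p = 0, u = n, f = m, b = k
-- its two factors are the two fractions of the theorem.

open import Defs
open import Data.Nat using (ℕ; suc; _+_; _*_; _∸_; _/_; _≤_; _<_)
open import Data.Nat.Combinatorics using (_C_)
open import Relation.Binary.PropositionalEquality using (_≡_)

open import Data.Bool using (Bool; true; false; _∧_; T?)
open import Data.Bool.Properties using (∧-zeroʳ)
open import Data.Integer as ℤ using (ℤ; -[1+_])
open import Data.List using (List; []; _∷_; length; map; _++_; filterᵇ)
open import Data.List.Properties using (filter-++; length-++)
open import Data.Nat using (zero; _≡ᵇ_; s≤s; z≤n; _≤?_)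
open import Data.Nat.Combinatorics using (k>n⇒nCk≡0; nCk≡nC[n∸k]; nC1≡n)
  renaming (nCk+nC[k+1]≡[n+1]C[k+1] to pascal)
open import Data.Nat.DivMod using (m*n/n≡m)
open import Data.Nat.Properties
open import Algebra.Properties.CommutativeSemigroup +-commutativeSemigroup using (interchange)
open import Data.Nat.Solver using (module +-*-Solver)
open import Data.Product using (_,_)
open import Data.Vec using (Vec; _∷_)
open import Function using (_∘_)
open import Relation.Binary.PropositionalEquality
  using (refl; sym; trans; cong; cong₂; subst; module ≡-Reasoning)
open import Relation.Nullary using (yes; no)
open ≡-Reasoning
open +-*-Solver using (solve; _:+_; _:*_; _:=_; con)

count : {A : Set} → (A → Bool) → List A → ℕ
count p xs = length (filterᵇ p xs)

module _ {A : Set} where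

  count-++ : ∀ (p : A → Bool) xs ys → count p (xs ++ ys) ≡ count p xs + count p ys
  count-++ p xs ys = trans (cong length (filter-++ (T? ∘ p) xs ys)) (length-++ (filterᵇ p xs))

  count-map : ∀ {B : Set} (p : B → Bool) (g : A → B) xs → count p (map g xs) ≡ count (p ∘ g) xs
  count-map p g [] = refl
  count-map p g (x ∷ xs) with p (g x)
  ... | true  = cong suc (count-map p g xs)
  ... | false = count-map p g xs

  count-cong : ∀ {p q : A → Bool} → (∀ x → p x ≡ q x) → ∀ xs → count p xs ≡ count q xs
  count-cong p≗q [] = refl
  count-cong {p} {q} p≗q (x ∷ xs) with p x | q x | p≗q x
  ... | true  | true  | refl = cong suc (count-cong p≗q xs)
  ... | false | false | refl = count-cong p≗q xs

  count-reject : ∀ {p : A → Bool} → (∀ x → p x ≡ false) → ∀ xs → count p xs ≡ 0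
  count-reject p≗false [] = refl
  count-reject {p} p≗false (x ∷ xs) with p x | p≗false x
  ... | false | refl = count-reject p≗false xs

count-allPaths-suc : ∀ L (p : Vec Bool (suc L) → Bool) →
  count p (allPaths (suc L)) ≡ count (p ∘ (true ∷_)) (allPaths L) + count (p ∘ (false ∷_)) (allPaths L)
count-allPaths-suc L p = trans (count-++ p (map (true ∷_) (allPaths L)) _)
  (cong₂ _+_ (count-map p (true ∷_) (allPaths L)) (count-map p (false ∷_) (allPaths L)))

isCountedFrom : ∀ {L} → ℤ → ℕ → ℕ → ℕ → Vec Bool L → Bool
isCountedFrom h u f b s = (ups s ≡ᵇ u) ∧ (flawsFrom h s ≡ᵇ f) ∧ (blocksFrom h s ≡ᵇ b)

emptyWalk : ℕ → ℕ → ℕ → ℕ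
emptyWalk zero zero zero = 1
emptyWalk _    _    _    = 0

-- walks⁺ L p u f b counts the step sequences of length L that, started at height p, have
-- u up steps, f flaws and b flaw blocks; walks⁻ L j u f b does so from height −(j + 1).
mutual
  walks⁺ : ℕ → ℕ → ℕ → ℕ → ℕ → ℕ
  walks⁺ zero    p u f b = emptyWalk u f b
  walks⁺ (suc L) p u f b = up⁺ L p u f b + down⁺ L p u f b

  up⁺ : ℕ → ℕ → ℕ → ℕ → ℕ → ℕ
  up⁺ L p zero    f b = 0
  up⁺ L p (suc u) f b = walks⁺ L (suc p) u f b

  down⁺ : ℕ → ℕ → ℕ → ℕ → ℕ → ℕ
  down⁺ L zero    u f zero    = 0
  down⁺ L zero    u f (suc b) = walks⁻ L 0 u f b
  down⁺ L (suc p) u f b       = walks⁺ L p u f b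

  walks⁻ : ℕ → ℕ → ℕ → ℕ → ℕ → ℕ
  walks⁻ zero    j u f b = emptyWalk u f b
  walks⁻ (suc L) j u f b = up⁻ L j u f b + walks⁻ L (suc j) u f b

  up⁻ : ℕ → ℕ → ℕ → ℕ → ℕ → ℕ
  up⁻ L j       zero    f       b = 0
  up⁻ L j       (suc u) zero    b = 0
  up⁻ L zero    (suc u) (suc f) b = walks⁺ L 0 u f b
  up⁻ L (suc j) (suc u) (suc f) b = walks⁻ L j u f b

count-allPaths-zero : ∀ h u f b → count (isCountedFrom h u f b) (allPaths 0) ≡ emptyWalk u f b
count-allPaths-zero h zero    zero    zero    = refl
count-allPaths-zero h zero    zero    (suc b) = refl
count-allPaths-zero h zero    (suc f) b       = refl
count-allPaths-zero h (suc u) f       b       = refl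

mutual
  count≡walks⁺ : ∀ L p u f b → count (isCountedFrom (ℤ.+ p) u f b) (allPaths L) ≡ walks⁺ L p u f b
  count≡walks⁺ zero    p u f b = count-allPaths-zero (ℤ.+ p) u f b
  count≡walks⁺ (suc L) p u f b = trans (count-allPaths-suc L _)
    (cong₂ _+_ (count-up≡up⁺ L p u f b) (count-down≡down⁺ L p u f b))

  count-up≡up⁺ : ∀ L p u f b →
    count (λ s → isCountedFrom (ℤ.+ p) u f b (true ∷ s)) (allPaths L) ≡ up⁺ L p u f b
  count-up≡up⁺ L p zero    f b = count-reject (λ _ → refl) (allPaths L)
  count-up≡up⁺ L p (suc u) f b = trans
    (count-cong (λ s → cong (λ h → (ups s ≡ᵇ u) ∧ (flawsFrom (ℤ.+ suc p) s ≡ᵇ f) ∧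
                                    (blocksFrom h s ≡ᵇ b))
                            (cong ℤ.+_ (+-comm p 1)))
                (allPaths L))
    (count≡walks⁺ L (suc p) u f b)

  count-down≡down⁺ : ∀ L p u f b →
    count (λ s → isCountedFrom (ℤ.+ p) u f b (false ∷ s)) (allPaths L) ≡ down⁺ L p u f b
  count-down≡down⁺ L zero    u f zero    = count-reject
    (λ s → trans (cong ((ups s ≡ᵇ u) ∧_) (∧-zeroʳ _)) (∧-zeroʳ _)) (allPaths L)
  count-down≡down⁺ L zero    u f (suc b) = count≡walks⁻ L 0 u f b
  count-down≡down⁺ L (suc p) u f b       = count≡walks⁺ L p u f b

  count≡walks⁻ : ∀ L j u f b → count (isCountedFrom -[1+ j ] u f b) (allPaths L) ≡ walks⁻ L j u f b
  count≡walks⁻ zero    j u f b = count-allPaths-zero -[1+ j ] u f b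
  count≡walks⁻ (suc L) j u f b = trans (count-allPaths-suc L _)
    (cong₂ _+_ (count-up≡up⁻ L j u f b) (count-down≡walks⁻ L j u f b))

  count-up≡up⁻ : ∀ L j u f b →
    count (λ s → isCountedFrom -[1+ j ] u f b (true ∷ s)) (allPaths L) ≡ up⁻ L j u f b
  count-up≡up⁻ L j       zero    f       b = count-reject (λ _ → refl) (allPaths L)
  count-up≡up⁻ L j       (suc u) zero    b = count-reject (λ _ → ∧-zeroʳ _) (allPaths L)
  count-up≡up⁻ L zero    (suc u) (suc f) b = count≡walks⁺ L 0 u f b
  count-up≡up⁻ L (suc j) (suc u) (suc f) b = count≡walks⁻ L j u f b

  count-down≡walks⁻ : ∀ L j u f b →
    count (λ s → isCountedFrom -[1+ j ] u f b (false ∷ s)) (allPaths L) ≡ walks⁻ L (suc j) u f b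
  count-down≡walks⁻ L j u f b = trans
    (count-cong (λ s → cong (λ i → isCountedFrom -[1+ suc i ] u f b s) (+-identityʳ j)) (allPaths L))
    (count≡walks⁻ L (suc j) u f b)

ballot : ℕ → ℕ → ℕ
ballot q       zero    = 1
ballot zero    (suc a) = ballot 1 a
ballot (suc q) (suc a) = ballot (suc (suc q)) a + ballot q (suc a)

-- nonnegPart q u f = ballot q (u − f) and, for r ≥ 1, flawPart r f = ballot (r − 1) (f − r),
-- except that both are 0 (not a truncated value) when the difference would be negative.
nonnegPart : ℕ → ℕ → ℕ → ℕ
nonnegPart q u       zero    = ballot q u
nonnegPart q zero    (suc f) = 0
nonnegPart q (suc u) (suc f) = nonnegPart q u f

flawPart : ℕ → ℕ → ℕ
flawPart zero    zero    = 1
flawPart zero    (suc f) = 0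
flawPart (suc r) f       = nonnegPart r f (suc r)

nonnegPart-+ : ∀ q f a → nonnegPart q (f + a) f ≡ ballot q a
nonnegPart-+ q zero    a = refl
nonnegPart-+ q (suc f) a = nonnegPart-+ q f a

nonnegPart-noUps : ∀ q q′ f → nonnegPart q 0 f ≡ nonnegPart q′ 0 f
nonnegPart-noUps q q′ zero    = refl
nonnegPart-noUps q q′ (suc f) = refl

nonnegPart-recurrence : ∀ q u f →
  nonnegPart (suc q) (suc u) f ≡ nonnegPart (suc (suc q)) u f + nonnegPart q (suc u) f
nonnegPart-recurrence q u       zero          = refl
nonnegPart-recurrence q zero    (suc zero)    = refl
nonnegPart-recurrence q zero    (suc (suc f)) = refl
nonnegPart-recurrence q (suc u) (suc f)       = nonnegPart-recurrence q u f

flawPart-recurrence : ∀ r f → flawPart (suc r) (suc f) ≡ flawPart r f + flawPart (suc (suc r)) (suc f)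
flawPart-recurrence zero    zero    = refl
flawPart-recurrence zero    (suc f) = refl
flawPart-recurrence (suc r) zero    = refl
flawPart-recurrence (suc r) (suc f) =
  trans (nonnegPart-recurrence r f (suc r)) (+-comm (nonnegPart (suc (suc r)) f (suc r)) _)

nonnegPart-vanishes : ∀ q u f → u < f → nonnegPart q u f ≡ 0
nonnegPart-vanishes q zero    (suc f) _         = refl
nonnegPart-vanishes q (suc u) (suc f) (s≤s u<f) = nonnegPart-vanishes q u f u<f

flawPart-vanishes : ∀ r f → f < r → flawPart r f ≡ 0
flawPart-vanishes (suc r) f (s≤s f≤r) = nonnegPart-vanishes r f (suc r) (s≤s f≤r)

nonnegPart*flawPart-vanishes : ∀ q u f r → u < r → nonnegPart q u f * flawPart r f ≡ 0
nonnegPart*flawPart-vanishes q u f r u<r with f ≤? u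
... | yes f≤u = trans (cong (nonnegPart q u f *_) (flawPart-vanishes r f (≤-<-trans f≤u u<r)))
                      (*-zeroʳ (nonnegPart q u f))
... | no  f≰u = cong (_* flawPart r f) (nonnegPart-vanishes q u f (≰⇒> f≰u))

emptyWalk-factorises : ∀ f b → emptyWalk 0 f b ≡ nonnegPart b 0 f * flawPart b f
emptyWalk-factorises zero    zero    = refl
emptyWalk-factorises zero    (suc b) = refl
emptyWalk-factorises (suc f) b       = refl

nonnegPart-recurrence-* : ∀ q u f c {s t} →
  s ≡ nonnegPart (suc (suc q)) u f * c → t ≡ nonnegPart q (suc u) f * c →
  s + t ≡ nonnegPart (suc q) (suc u) f * c
nonnegPart-recurrence-* q u f c refl refl = begin
  x * c + y * c                    ≡⟨ *-distribʳ-+ c x y ⟨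
  (x + y) * c                      ≡⟨ cong (_* c) (nonnegPart-recurrence q u f) ⟨
  nonnegPart (suc q) (suc u) f * c ∎
  where
    x = nonnegPart (suc (suc q)) u f
    y = nonnegPart q (suc u) f

nonnegPart-fromAxis : ∀ u f → nonnegPart 1 u f * flawPart 0 f ≡ nonnegPart 0 (suc u) f * flawPart 0 f
nonnegPart-fromAxis u zero    = refl
nonnegPart-fromAxis u (suc f) = trans (*-zeroʳ (nonnegPart 1 u (suc f))) (sym (*-zeroʳ (nonnegPart 0 u f)))

length-after-up⁺ : ∀ p {L u} → suc L ≡ p + (suc u + suc u) → L ≡ suc p + (u + u)
length-after-up⁺ p {L} {u} e = suc-injective (trans e (solve 2 (λ p u →
  p :+ ((con 1 :+ u) :+ (con 1 :+ u)) := con 1 :+ ((con 1 :+ p) :+ (u :+ u))) refl p u))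

length-after-up⁻ : ∀ L j {u} → suc L + suc j ≡ suc u + suc u → L + j ≡ u + u
length-after-up⁻ L j {u} e =
  suc-injective (suc-injective (trans (cong suc (sym (+-suc L j))) (trans e (cong suc (+-suc u u)))))

length-after-down⁻ : ∀ L {j n} → suc L + suc j ≡ n → L + suc (suc j) ≡ n
length-after-down⁻ L {j} e = trans (+-suc L (suc j)) e

-- The length hypotheses say that the walks end at height 0.
mutual
  walks⁺-factorises : ∀ L p u f b → L ≡ p + (u + u) →
    walks⁺ L p u f b ≡ nonnegPart (p + b) u f * flawPart b f
  walks⁺-factorises zero zero    zero    f b refl = emptyWalk-factorises f b
  walks⁺-factorises (suc L) (suc p) zero f b e = begin
    walks⁺ L p 0 f b
      ≡⟨ walks⁺-factorises L p 0 f b (suc-injective e) ⟩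
    nonnegPart (p + b) 0 f * flawPart b f
      ≡⟨ cong (_* flawPart b f) (nonnegPart-noUps (p + b) (suc p + b) f) ⟩
    nonnegPart (suc p + b) 0 f * flawPart b f ∎
  walks⁺-factorises (suc L) (suc p) (suc u) f b e = nonnegPart-recurrence-* (p + b) u f (flawPart b f)
    (walks⁺-factorises L (suc (suc p)) u f b (length-after-up⁺ (suc p) e))
    (walks⁺-factorises L p (suc u) f b (suc-injective e))
  walks⁺-factorises (suc L) zero (suc u) f zero e = trans (+-identityʳ _)
    (trans (walks⁺-factorises L 1 u f 0 (length-after-up⁺ 0 e)) (nonnegPart-fromAxis u f))
  walks⁺-factorises (suc L) zero (suc u) f (suc b) e = nonnegPart-recurrence-* b u f (flawPart (suc b) f)
    (walks⁺-factorises L 1 u f (suc b) (length-after-up⁺ 0 e))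
    (walks⁻-factorises L 0 (suc u) f b (trans (+-comm L 1) e))

  walks⁻-factorises : ∀ L j u f b → L + suc j ≡ u + u →
    walks⁻ L j u f b ≡ nonnegPart b u f * flawPart (suc j + b) f
  walks⁻-factorises zero j (suc u) f b e =
    sym (nonnegPart*flawPart-vanishes b (suc u) f (suc j + b) (≤-trans u<j+1 (m≤m+n (suc j) b)))
    where
      u<j+1 : suc u < suc j
      u<j+1 = subst (suc u <_) (sym e) (m<m+n (suc u) (s≤s z≤n))
  walks⁻-factorises (suc L) j (suc u) zero b e =
    walks⁻-factorises L (suc j) (suc u) 0 b (length-after-down⁻ L e)
  walks⁻-factorises (suc L) j (suc u) (suc f) b e = begin
    up⁻ L j (suc u) (suc f) b + walks⁻ L (suc j) (suc u) (suc f) b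
      ≡⟨ cong₂ _+_ (up⁻-factorises L j u f b e)
                   (walks⁻-factorises L (suc j) (suc u) (suc f) b (length-after-down⁻ L e)) ⟩
    N * flawPart (j + b) f + N * flawPart (suc (suc (j + b))) (suc f)
      ≡⟨ *-distribˡ-+ N _ _ ⟨
    N * (flawPart (j + b) f + flawPart (suc (suc (j + b))) (suc f))
      ≡⟨ cong (N *_) (flawPart-recurrence (j + b) f) ⟨
    N * flawPart (suc (j + b)) (suc f) ∎
    where N = nonnegPart b u f

  up⁻-factorises : ∀ L j u f b → suc L + suc j ≡ suc u + suc u →
    up⁻ L j (suc u) (suc f) b ≡ nonnegPart b u f * flawPart (j + b) f
  up⁻-factorises L zero    u f b e =
    walks⁺-factorises L 0 u f b (trans (sym (+-identityʳ L)) (length-after-up⁻ L 0 e))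
  up⁻-factorises L (suc j) u f b e = walks⁻-factorises L j u f b (length-after-up⁻ L (suc j) e)

countPaths-factorises : ∀ n m k → countPaths n m k ≡ nonnegPart k n m * flawPart k m
countPaths-factorises n m k =
  trans (count≡walks⁺ (2 * n) 0 n m k) (walks⁺-factorises (2 * n) 0 n m k (cong (n +_) (+-identityʳ n)))

ballot-one : ∀ q → ballot q 1 ≡ suc q
ballot-one zero    = refl
ballot-one (suc q) = cong suc (ballot-one q)

C-absorption : ∀ n k → suc k * (suc n C suc k) ≡ suc n * (n C k)
C-absorption zero    zero    = refl
C-absorption zero    (suc k) = begin
  suc (suc k) * (1 C suc (suc k)) ≡⟨ cong (suc (suc k) *_) (k>n⇒nCk≡0 {1} {suc (suc k)} (s≤s (s≤s z≤n))) ⟩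
  suc (suc k) * 0                 ≡⟨ *-zeroʳ (suc (suc k)) ⟩
  0                               ≡⟨ cong (1 *_) (k>n⇒nCk≡0 {0} {suc k} (s≤s z≤n)) ⟨
  1 * (0 C suc k)                 ∎
C-absorption (suc n) zero    = begin
  1 * (suc (suc n) C 1) ≡⟨ *-identityˡ _ ⟩
  suc (suc n) C 1       ≡⟨ nC1≡n (suc (suc n)) ⟩
  suc (suc n)           ≡⟨ *-identityʳ (suc (suc n)) ⟨
  suc (suc n) * 1       ∎
C-absorption (suc n) (suc k) = begin
  suc (suc k) * (suc (suc n) C suc (suc k))
    ≡⟨ cong (suc (suc k) *_) (pascal (suc n) (suc k)) ⟨
  suc (suc k) * (X + Y)
    ≡⟨ *-distribˡ-+ (suc (suc k)) X Y ⟩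
  (X + suc k * X) + suc (suc k) * Y
    ≡⟨ +-assoc X (suc k * X) _ ⟩
  X + (suc k * X + suc (suc k) * Y)
    ≡⟨ cong (X +_) (cong₂ _+_ (C-absorption n k) (C-absorption n (suc k))) ⟩
  X + (suc n * (n C k) + suc n * (n C suc k))
    ≡⟨ cong (X +_) (*-distribˡ-+ (suc n) (n C k) (n C suc k)) ⟨
  X + suc n * (n C k + n C suc k)
    ≡⟨ cong (λ c → X + suc n * c) (pascal n k) ⟩
  suc (suc n) * X ∎
  where
    X = suc n C suc k
    Y = suc n C suc (suc k)

C-middle : ∀ a → (suc a + suc (suc a)) C suc a ≡ (suc a + suc (suc a)) C suc (suc a)
C-middle a = trans (nCk≡nC[n∸k] (m≤m+n (suc a) (suc (suc a))))
                   (cong ((suc a + suc (suc a)) C_) (m+n∸m≡n (suc a) (suc (suc a))))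

ballot-reflection : ∀ q a → ballot q (suc a) + (suc a + suc a + q) C a ≡ (suc a + suc a + q) C suc a
ballot-reflection q       zero    = begin
  ballot q 1 + 1       ≡⟨ +-comm (ballot q 1) 1 ⟩
  suc (ballot q 1)     ≡⟨ cong suc (ballot-one q) ⟩
  suc (suc q)          ≡⟨ nC1≡n (suc (suc q)) ⟨
  suc (suc q) C 1      ∎
ballot-reflection zero    (suc a) = begin
  ballot 1 (suc a) + N C suc a
    ≡⟨ cong (λ n → ballot 1 (suc a) + n C suc a) N≡ ⟩
  ballot 1 (suc a) + suc M C suc a
    ≡⟨ cong (ballot 1 (suc a) +_) (pascal M a) ⟨
  ballot 1 (suc a) + (M C a + M C suc a)
    ≡⟨ +-assoc (ballot 1 (suc a)) (M C a) (M C suc a) ⟨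
  (ballot 1 (suc a) + M C a) + M C suc a
    ≡⟨ cong (_+ M C suc a) reflection-a ⟩
  M C suc a + M C suc a
    ≡⟨ cong (M C suc a +_) (C-middle a) ⟩
  M C suc a + M C suc (suc a)
    ≡⟨ pascal M (suc a) ⟩
  suc M C suc (suc a)
    ≡⟨ cong (_C suc (suc a)) N≡ ⟨
  N C suc (suc a) ∎
  where
    N = suc (suc a) + suc (suc a) + 0
    M = suc a + suc (suc a)
    N≡ : N ≡ suc M
    N≡ = +-identityʳ _
    reflection-a : ballot 1 (suc a) + M C a ≡ M C suc a
    reflection-a = subst (λ n → ballot 1 (suc a) + n C a ≡ n C suc a)
      (solve 1 (λ a → (con 1 :+ a) :+ (con 1 :+ a) :+ con 1 := (con 1 :+ a) :+ (con 2 :+ a)) refl a)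
      (ballot-reflection 1 a)
ballot-reflection (suc q) (suc a) = begin
  (ballot (suc (suc q)) (suc a) + ballot q (suc (suc a))) + N C suc a
    ≡⟨ cong (λ n → ballot (suc (suc q)) (suc a) + ballot q (suc (suc a)) + n C suc a) N≡ ⟩
  (ballot (suc (suc q)) (suc a) + ballot q (suc (suc a))) + suc M C suc a
    ≡⟨ cong (ballot (suc (suc q)) (suc a) + ballot q (suc (suc a)) +_) (pascal M a) ⟨
  (ballot (suc (suc q)) (suc a) + ballot q (suc (suc a))) + (M C a + M C suc a)
    ≡⟨ interchange (ballot (suc (suc q)) (suc a)) (ballot q (suc (suc a))) (M C a) (M C suc a) ⟩
  (ballot (suc (suc q)) (suc a) + M C a) + (ballot q (suc (suc a)) + M C suc a)
    ≡⟨ cong₂ _+_ reflection-a (ballot-reflection q (suc a)) ⟩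
  M C suc a + M C suc (suc a)
    ≡⟨ pascal M (suc a) ⟩
  suc M C suc (suc a)
    ≡⟨ cong (_C suc (suc a)) N≡ ⟨
  N C suc (suc a) ∎
  where
    N = suc (suc a) + suc (suc a) + suc q
    M = suc (suc a) + suc (suc a) + q
    N≡ : N ≡ suc M
    N≡ = +-suc (suc (suc a) + suc (suc a)) q
    reflection-a : ballot (suc (suc q)) (suc a) + M C a ≡ M C suc a
    reflection-a = subst (λ n → ballot (suc (suc q)) (suc a) + n C a ≡ n C suc a)
      (solve 2 (λ a q → (con 1 :+ a) :+ (con 1 :+ a) :+ (con 2 :+ q) := (con 2 :+ a) :+ (con 2 :+ a) :+ q)
             refl a q)
      (ballot-reflection (suc (suc q)) a)

ballot-closed-form : ∀ q a → suc (a + a + q) * ballot q a ≡ suc q * (suc (a + a + q) C a)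
ballot-closed-form q zero    = refl
ballot-closed-form q (suc a) = +-cancelʳ-≡ (c + c) _ _ (begin
  suc M * X + (c + c)                     ≡⟨ cong (λ t → suc M * X + (t + t)) (C-absorption M a) ⟩
  suc M * X + (suc M * Z + suc M * Z)     ≡⟨ cong (suc M * X +_) (*-distribˡ-+ (suc M) Z Z) ⟨
  suc M * X + suc M * (Z + Z)             ≡⟨ *-distribˡ-+ (suc M) X (Z + Z) ⟨
  suc M * (X + (Z + Z))                   ≡⟨ cong (suc M *_) (+-assoc X Z Z) ⟨
  suc M * ((X + Z) + Z)                   ≡⟨ cong (λ t → suc M * (t + Z)) (ballot-reflection q a) ⟩
  suc M * (M C suc a + Z)                 ≡⟨ cong (suc M *_) (+-comm (M C suc a) Z) ⟩
  suc M * (Z + M C suc a)                 ≡⟨ cong (suc M *_) (pascal M a) ⟩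
  suc M * Y                               ≡⟨ cong (_* Y) (cong suc (+-comm (suc a + suc a) q)) ⟩
  (suc q + (suc a + suc a)) * Y           ≡⟨ *-distribʳ-+ Y (suc q) (suc a + suc a) ⟩
  suc q * Y + (suc a + suc a) * Y         ≡⟨ cong (suc q * Y +_) (*-distribʳ-+ Y (suc a) (suc a)) ⟩
  suc q * Y + (c + c)                     ∎)
  where
    M = suc a + suc a + q
    X = ballot q (suc a)
    Y = suc M C suc a
    Z = M C a
    c = suc a * Y

ballot≡quotient : ∀ q a → ballot q a ≡ (suc q * (suc (a + a + q) C a)) / suc (a + a + q)
ballot≡quotient q a = begin
  ballot q a                                    ≡⟨ m*n/n≡m (ballot q a) (suc (a + a + q)) ⟨
  ballot q a * suc (a + a + q) / suc (a + a + q) ≡⟨ cong (_/ suc (a + a + q)) (*-comm (ballot q a) _) ⟩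
  suc (a + a + q) * ballot q a / suc (a + a + q) ≡⟨ cong (_/ suc (a + a + q)) (ballot-closed-form q a) ⟩
  suc q * (suc (a + a + q) C a) / suc (a + a + q) ∎

2*[1+k+s]∸[1+k]≡1+s+s+k : ∀ k s → 2 * (suc k + s) ∸ suc k ≡ suc (s + s + k)
2*[1+k+s]∸[1+k]≡1+s+s+k k s = trans
  (cong (_∸ suc k)
    (solve 2 (λ k s → con 2 :* (con 1 :+ k :+ s) := (con 1 :+ k) :+ (con 1 :+ (s :+ s :+ k))) refl k s))
  (m+n∸m≡n (suc k) (suc (s + s + k)))

2*[m+a]∸2*m≡a+a : ∀ m a → 2 * (m + a) ∸ 2 * m ≡ a + a
2*[m+a]∸2*m≡a+a m a = trans
  (cong (_∸ 2 * m) (solve 2 (λ m a → con 2 :* (m :+ a) := con 2 :* m :+ (a :+ a)) refl m a))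
  (m+n∸m≡n (2 * m) (a + a))

flawFactor≡ballot : ∀ k s →
  (suc k * ((2 * (suc k + s) ∸ suc k) C (suc k + s))) / suc (2 * (suc k + s) ∸ suc k ∸ 1) ≡ ballot k s
flawFactor≡ballot k s rewrite 2*[1+k+s]∸[1+k]≡1+s+s+k k s = begin
  (suc k * (suc (s + s + k) C (suc k + s))) / suc (s + s + k)
    ≡⟨ cong (λ c → (suc k * c) / suc (s + s + k)) C-symmetry ⟨
  (suc k * (suc (s + s + k) C s)) / suc (s + s + k)
    ≡⟨ ballot≡quotient k s ⟨
  ballot k s ∎
  where
    swap : suc (s + s + k) ≡ (suc k + s) + s
    swap = solve 2 (λ k s → con 1 :+ (s :+ s :+ k) := (con 1 :+ k :+ s) :+ s) refl k s
    C-symmetry : suc (s + s + k) C s ≡ suc (s + s + k) C (suc k + s)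
    C-symmetry = trans (nCk≡nC[n∸k] (subst (s ≤_) (sym swap) (m≤n+m s (suc k + s))))
                       (cong (suc (s + s + k) C_) (trans (cong (_∸ s) swap) (m+n∸n≡m (suc k + s) s)))

nonnegFactor≡ballot : ∀ m k a →
  ((k + 1) * ((2 * (m + a) ∸ 2 * m + k + 1) C (m + a ∸ m))) / suc (2 * (m + a) ∸ 2 * m + k) ≡ ballot k a
nonnegFactor≡ballot m k a
  rewrite 2*[m+a]∸2*m≡a+a m a | m+n∸m≡n m a | +-comm k 1 | +-comm (a + a + k) 1 =
    sym (ballot≡quotient k a)

corollary3p4 : (n m k : ℕ) → (0<k : 0 < k) → (k≤m : k ≤ m) → (m≤n : m ≤ n) →
    countPaths n m k
    ≡ ((k * ((2 * m ∸ k) C m)) / suc (2 * m ∸ k ∸ 1))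
    * (((k + 1) * ((2 * n ∸ 2 * m + k + 1) C (n ∸ m))) / suc (2 * n ∸ 2 * m + k))
corollary3p4 n m (suc k) _ k≤m m≤n with m≤n⇒∃[o]m+o≡n k≤m | m≤n⇒∃[o]m+o≡n m≤n
... | s , refl | a , refl = begin
  countPaths (suc k + s + a) (suc k + s) (suc k)
    ≡⟨ countPaths-factorises (suc k + s + a) (suc k + s) (suc k) ⟩
  nonnegPart (suc k) (suc k + s + a) (suc k + s) * flawPart (suc k) (suc k + s)
    ≡⟨ *-comm (nonnegPart (suc k) (suc k + s + a) (suc k + s)) _ ⟩
  flawPart (suc k) (suc k + s) * nonnegPart (suc k) (suc k + s + a) (suc k + s)
    ≡⟨ cong₂ _*_ (nonnegPart-+ k (suc k) s) (nonnegPart-+ (suc k) (suc k + s) a) ⟩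
  ballot k s * ballot (suc k) a
    ≡⟨ cong₂ _*_ (flawFactor≡ballot k s) (nonnegFactor≡ballot (suc k + s) (suc k) a) ⟨
  _ ∎
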